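{- Let $G$ be a connected chain graph and let $P^*$ be an optimal path cover of $G$. Then $\mathrm{Opt}(G)\ge |E(P^*)|-2$.
   Context: A chain graph is a bipartite graph $G=(X,Y,E)$ whose vertices of $X$ can be ordered $x_1,\dots,x_{n_1}$ with $N(x_1)\subseteq N(x_2)\subseteq\dots\subseteq N(x_{n_1})$. A path cover of $G$ is a spanning subgraph every component of which is a path; an optimal path cover is a path cover with the maximum number of edges, and $|E(P^*)|$ is its number of edges. $\mathrm{Opt}(G)$ denotes the maximum, over all spanning trees $T$ of $G$, of the number of vertices of degree at least $2$ in $T$. -}

module Defs where

open import Data.Nat using (ℕ; zero; suc; _+_; _∸_; _≤_; _≤ᵇ_)
open import Data.Fin using (Fin)
open import Data.Bool using (Bool; true; false; if_then_else_)
open import Data.List using (List; []; _∷_; length; map; concat; last)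
open import Data.Nat.ListAction using (sum)
open import Data.Maybe using (just)
open import Data.List.Membership.Propositional using (_∈_)
open import Data.List.Relation.Unary.Unique.Propositional using (Unique)
open import Data.List.Relation.Unary.All using (All)
open import Data.Vec using (tabulate)
import Data.Vec as Vec
open import Data.Product using (Σ; ∃; _×_)
open import Data.Unit using (⊤)
open import Relation.Nullary using (¬_)
open import Relation.Binary.PropositionalEquality using (_≡_; _≢_)
open import Relation.Binary.Construct.Closure.ReflexiveTransitive using (Star)

BRel : ℕ → Set
BRel n = Fin n → Fin n → Bool

record Graph (n : ℕ) : Set where
  field
    adj  : BRel n
    sym  : ∀ u v → adj u v ≡ adj v u
    irr  : ∀ v → adj v v ≡ false
open Graph public

count : ∀ {n} → (Fin n → Bool) → ℕ
count {n} f = Vec.sum (tabulate (λ i → if f i then 1 else 0))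

Linked : ∀ {n} → BRel n → List (Fin n) → Set
Linked A []           = ⊤
Linked A (x ∷ [])     = ⊤
Linked A (x ∷ y ∷ r)  = (A x y ≡ true) × Linked A (y ∷ r)

Joined : ∀ {n} → BRel n → Fin n → Fin n → Set
Joined A = Star (λ a b → A a b ≡ true)

Connected : ∀ {n} → Graph n → Set
Connected G = ∀ u v → Joined (adj G) u v

-- Chain graphs
-- G = (X, Y, E) bipartite, X = {v | side v ≡ true}, Y = {v | side v ≡ false};
-- the vertices of X can be ordered x_0, …, x_{k-1} (ord : Fin k → Fin n,
-- injective, image exactly X) with N(x_i) ⊆ N(x_j) whenever i ≤ j.
record ChainStructure {n : ℕ} (G : Graph n) : Set where
  field
    side      : Fin n → Bool
    bipartite : ∀ u v → adj G u v ≡ true → side u ≢ side v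
    k         : ℕ
    ord       : Fin k → Fin n
    ord-inj   : ∀ i j → ord i ≡ ord j → i ≡ j
    ord-inX   : ∀ i → side (ord i) ≡ true
    ord-onto  : ∀ v → side v ≡ true → ∃ λ i → ord i ≡ v
    nested    : ∀ (i j : Fin k) → Data.Fin._≤_ i j →
                ∀ y → adj G (ord i) y ≡ true → adj G (ord j) y ≡ true

IsChainGraph : ∀ {n} → Graph n → Set
IsChainGraph G = ChainStructure G

IsPath : ∀ {n} → Graph n → List (Fin n) → Set
IsPath G p = (p ≢ []) × Unique p × Linked (adj G) p

record PathCover {n : ℕ} (G : Graph n) : Set where
  field
    paths    : List (List (Fin n))
    arePaths : All (IsPath G) paths
    disjoint : Unique (concat paths)
    covers   : ∀ v → v ∈ concat paths

pcEdges : ∀ {n} {G : Graph n} → PathCover G → ℕ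
pcEdges P = sum (map (λ p → length p ∸ 1) (PathCover.paths P))

IsOptimalPathCover : ∀ {n} (G : Graph n) → PathCover G → Set
IsOptimalPathCover G P = ∀ (Q : PathCover G) → pcEdges Q ≤ pcEdges P

HasCycle : ∀ {n} → BRel n → Set
HasCycle {n} A = Σ (Fin n) λ a → Σ (Fin n) λ b → Σ (Fin n) λ c → Σ (List (Fin n)) λ r →
  Unique (a ∷ b ∷ c ∷ r) × Linked A (a ∷ b ∷ c ∷ r) ×
  Σ (Fin n) λ z → (last (a ∷ b ∷ c ∷ r) ≡ just z) × (A z a ≡ true)

record SpanningTree {n : ℕ} (G : Graph n) : Set where
  field
    edge      : BRel n
    sym       : ∀ u v → edge u v ≡ edge v u
    sub       : ∀ u v → edge u v ≡ true → adj G u v ≡ true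
    connected : ∀ u v → Joined edge u v
    acyclic   : ¬ HasCycle edge

degT : ∀ {n} {G : Graph n} → SpanningTree G → Fin n → ℕ
degT T v = count (SpanningTree.edge T v)

nonLeaves : ∀ {n} {G : Graph n} → SpanningTree G → ℕ
nonLeaves T = count (λ v → 2 ≤ᵇ degT T v)

-- Opt(G) ≥ m  (Opt(G) is the maximum of nonLeaves over spanning trees)
OptAtLeast : ∀ {n} → Graph n → ℕ → Set
OptAtLeast G m = Σ (SpanningTree G) λ T → m ≤ nonLeaves T

-- A connected chain graph with at least two vertices has a dominating edge hg: h, the last vertex
-- of X, is adjacent to all of Y, and g, a neighbour of the first vertex of X, to all of X.  Given
-- any path cover, root a spanning tree at an end of the path through h,
-- keep the edges of every path, and hang each other path below h or g by its first vertex.  Every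
-- vertex of a path except its two ends then has a parent and a child, and so does the first vertex
-- of each hung path, so a path with m edges yields m vertices of degree at least 2, the root path
-- m - 1.  If g is not on the root path, its path is cut at g into two paths hung below h and g,
-- losing one more.  Every parent precedes its child in the order of attachment, which makes the
-- result a tree.
module Submission where

open import Defs hiding (sym)
open import Data.Nat using (ℕ; zero; suc; _+_; _∸_; _≤_; _<_; z≤n; s≤s; _≤ᵇ_)
open import Data.Nat.Properties
  using (≤-trans; ≤-reflexive; <-trans; <-irrefl; <⇒≢; <-≤-trans; +-suc; +-comm; +-assoc;
         m∸n≤m; ∸-monoʳ-≤; +-monoʳ-≤; +-mono-≤; m≤n⇒m∸n≡0; n≤1+n)
open import Data.Nat.Induction using (<-wellFounded)
open import Induction.WellFounded using (Acc; acc)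
open import Data.Fin using (Fin; zero; suc; _≟_; fromℕ) renaming (_≤_ to _≤ᶠ_)
open import Data.Fin.Properties using (≤fromℕ)
open import Data.Bool using (Bool; true; false; not; _∨_; if_then_else_)
open import Data.Bool.Properties using (∨-comm; ∨-zeroʳ; ¬-not)
open import Data.Maybe using (Maybe; just; nothing)
open import Data.Maybe.Properties using (just-injective; ≡-dec)
open import Data.List using (List; []; _∷_; _++_; [_]; length; last; map; concat; reverse; _ʳ++_)
open import Data.Nat.ListAction using (sum)
open import Data.Nat.ListAction.Properties using (sum-↭)
open import Data.List.Relation.Binary.Permutation.Propositional
  using (_↭_; ↭-refl; ↭-reflexive; ↭-sym; ↭-trans; ↭⇒↭ₛ; module PermutationReasoning)
import Data.List.Relation.Binary.Permutation.Propositional as ↭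
open import Data.List.Relation.Binary.Permutation.Propositional.Properties
  using (++⁺ˡ; ++⁺ʳ; shift; shifts; ∈-resp-↭; All-resp-↭; map⁺; ↭-reverse)
import Data.List.Relation.Binary.Permutation.Setoid.Properties as PermutationSetoid
open import Data.List.Properties using (++-assoc; ++-identityʳ; map-++; length-++; reverse-++; length-reverse)
open import Data.List.Relation.Binary.Sublist.Propositional using (_⊆_; []; _∷ʳ_; _∷_)
open import Data.List.Relation.Binary.Sublist.Propositional.Properties using (++⁺; All-resp-⊆)
import Data.List.Relation.Unary.All.Properties as AllProperties
open import Data.List.Membership.Propositional using (_∈_; _∉_)
open import Data.List.Relation.Unary.Any using (here; there)
open import Data.List.Relation.Unary.All as All using (All; []; _∷_)
open import Data.List.Relation.Unary.AllPairs as AllPairs using ([]; _∷_)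
open import Data.List.Relation.Unary.Unique.Propositional using (Unique)
open import Data.List.Membership.Propositional.Properties
  using (∈-++⁺ˡ; ∈-++⁺ʳ; ∈-++⁻; ∈-map⁺; ∈-∃++; ∈-concat⁻′)
open import Data.Product using (Σ; ∃; _×_; _,_; proj₁; proj₂)
open import Data.Sum using (_⊎_; inj₁; inj₂)
open import Data.Empty using (⊥; ⊥-elim)
open import Data.Unit using (⊤; tt)
open import Relation.Nullary using (¬_; Dec; yes; no; does)
open import Relation.Nullary.Decidable using (dec-true)
open import Relation.Binary.PropositionalEquality
  using (_≡_; _≢_; refl; sym; trans; cong; cong₂; subst; setoid)
open import Relation.Binary.Construct.Closure.ReflexiveTransitive using (ε; _◅_; _◅◅_)
import Relation.Binary.Construct.Closure.ReflexiveTransitive as Star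

unsuc : ∀ {n} → List (Fin (suc n)) → List (Fin n)
unsuc []           = []
unsuc (zero  ∷ xs) = unsuc xs
unsuc (suc i ∷ xs) = i ∷ unsuc xs

∈-unsuc : ∀ {n} {i : Fin n} xs → i ∈ unsuc xs → suc i ∈ xs
∈-unsuc (zero  ∷ xs) i∈ = there (∈-unsuc xs i∈)
∈-unsuc (suc j ∷ xs) (here refl) = here refl
∈-unsuc (suc j ∷ xs) (there i∈) = there (∈-unsuc xs i∈)

unique-unsuc : ∀ {n} {xs : List (Fin (suc n))} → Unique xs → Unique (unsuc xs)
unique-unsuc {xs = []}         []       = []
unique-unsuc {xs = zero  ∷ xs} (_ ∷ u)  = unique-unsuc u
unique-unsuc {xs = suc j ∷ xs} (j∉ ∷ u) =
  All.tabulate (λ i∈ j≡i → All.lookup j∉ (∈-unsuc xs i∈) (cong suc j≡i)) ∷ unique-unsuc u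

all-unsuc : ∀ {n} {P : Fin (suc n) → Set} xs → All P xs → All (λ i → P (suc i)) (unsuc xs)
all-unsuc []           []       = []
all-unsuc (zero  ∷ xs) (_ ∷ ps) = all-unsuc xs ps
all-unsuc (suc j ∷ xs) (p ∷ ps) = p ∷ all-unsuc xs ps

length-unsuc-∉ : ∀ {n} (xs : List (Fin (suc n))) → zero ∉ xs → length xs ≡ length (unsuc xs)
length-unsuc-∉ []           _  = refl
length-unsuc-∉ (zero  ∷ xs) 0∉ = ⊥-elim (0∉ (here refl))
length-unsuc-∉ (suc j ∷ xs) 0∉ = cong suc (length-unsuc-∉ xs (λ 0∈ → 0∉ (there 0∈)))

length-unsuc : ∀ {n} {xs : List (Fin (suc n))} → Unique xs → length xs ≤ suc (length (unsuc xs))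
length-unsuc {xs = []}         []       = z≤n
length-unsuc {xs = zero  ∷ xs} (0∉ ∷ _) =
  s≤s (≤-reflexive (length-unsuc-∉ xs (λ 0∈ → All.lookup 0∉ 0∈ refl)))
length-unsuc {xs = suc j ∷ xs} (_ ∷ u)  = s≤s (length-unsuc u)

length≤count : ∀ {n} (f : Fin n → Bool) {xs} → Unique xs → All (λ v → f v ≡ true) xs →
  length xs ≤ count f
length≤count {zero} f {[]} _ _ = z≤n
length≤count {suc n} f {xs} u fs with f zero in f0
... | true  = ≤-trans (length-unsuc u)
                (s≤s (length≤count (λ i → f (suc i)) (unique-unsuc u) (all-unsuc xs fs)))
... | false = ≤-trans (≤-reflexive (length-unsuc-∉ xs 0∉))
                (length≤count (λ i → f (suc i)) (unique-unsuc u) (all-unsuc xs fs))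
  where
  0∉ : zero ∉ xs
  0∉ 0∈ with () ← trans (sym f0) (All.lookup fs 0∈)

count-const-true : ∀ n → count (λ (_ : Fin n) → true) ≡ n
count-const-true zero    = refl
count-const-true (suc n) = cong suc (count-const-true n)

unique-length≤ : ∀ {n} {xs : List (Fin n)} → Unique xs → length xs ≤ n
unique-length≤ {n} {xs} u =
  subst (length xs ≤_) (count-const-true n) (length≤count (λ _ → true) u (All.tabulate (λ _ → refl)))

2≤count : ∀ {n} (f : Fin n → Bool) {u v} → u ≢ v → f u ≡ true → f v ≡ true → 2 ≤ count f
2≤count f u≢v fu fv = length≤count f ((u≢v ∷ []) ∷ [] ∷ []) (fu ∷ fv ∷ [])

pos : ∀ {n} → List (Fin n) → Fin n → ℕ
pos []       v = 0
pos (x ∷ xs) v with x ≟ v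
... | yes _ = 0
... | no  _ = suc (pos xs v)

pos-<-length : ∀ {n} (E F : List (Fin n)) {p} → p ∈ E → pos (E ++ F) p < length E
pos-<-length (x ∷ E) F {p} p∈ with x ≟ p
... | yes _ = s≤s z≤n
pos-<-length (x ∷ E) F (here refl) | no x≢p = ⊥-elim (x≢p refl)
pos-<-length (x ∷ E) F (there p∈) | no _ = s≤s (pos-<-length E F p∈)

length≤pos : ∀ {n} (E F : List (Fin n)) {v} → v ∉ E → length E ≤ pos (E ++ F) v
length≤pos []      F v∉ = z≤n
length≤pos (x ∷ E) F {v} v∉ with x ≟ v
... | yes refl = ⊥-elim (v∉ (here refl))
... | no _     = s≤s (length≤pos E F (λ v∈ → v∉ (there v∈)))

unique-++⇒∉ : ∀ {n} (E : List (Fin n)) {F v} → Unique (E ++ F) → v ∈ F → v ∉ E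
unique-++⇒∉ (x ∷ E) (x∉ ∷ u) v∈F (here refl) = All.lookup x∉ (∈-++⁺ʳ E v∈F) refl
unique-++⇒∉ (x ∷ E) (_ ∷ u)  v∈F (there v∈E) = unique-++⇒∉ E u v∈F v∈E

pos-++-< : ∀ {n} (E F : List (Fin n)) {p v} → Unique (E ++ F) → p ∈ E → v ∈ F →
  pos (E ++ F) p < pos (E ++ F) v
pos-++-< E F u p∈E v∈F = <-≤-trans (pos-<-length E F p∈E) (length≤pos E F (unique-++⇒∉ E u v∈F))

linked-snoc : ∀ {n} (R : BRel n) x xs {y z} → Linked R (x ∷ xs) → last (x ∷ xs) ≡ just z →
  R z y ≡ true → Linked R ((x ∷ xs) ++ [ y ])
linked-snoc R x []       lk refl Rzy = Rzy , tt
linked-snoc R x (w ∷ xs) (Rxw , lk) last≡ Rzy = Rxw , linked-snoc R w xs lk last≡ Rzy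

last-snoc : ∀ {n} (xs : List (Fin n)) y → last (xs ++ [ y ]) ≡ just y
last-snoc []           y = refl
last-snoc (x ∷ [])     y = refl
last-snoc (x ∷ w ∷ xs) y = last-snoc (w ∷ xs) y

last-∈ : ∀ {n} x (xs : List (Fin n)) {z} → last (x ∷ xs) ≡ just z → z ∈ x ∷ xs
last-∈ x []       refl  = here refl
last-∈ x (w ∷ xs) last≡ = there (last-∈ w xs last≡)

NoBacktrack : ∀ {n} → List (Fin n) → Set
NoBacktrack (u ∷ v ∷ w ∷ rs) = u ≢ w × NoBacktrack (v ∷ w ∷ rs)
NoBacktrack _                = ⊤

noBacktrack-snoc : ∀ {n} x (xs : List (Fin n)) {y} → Unique (x ∷ xs) → y ∉ x ∷ xs →
  NoBacktrack ((x ∷ xs) ++ [ y ])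
noBacktrack-snoc x []           _ _  = tt
noBacktrack-snoc x (w ∷ [])     _ y∉ = (λ x≡y → y∉ (here (sym x≡y))) , tt
noBacktrack-snoc x (w ∷ z ∷ xs) ((_ ∷ x≢z ∷ _) ∷ u) y∉ =
  x≢z , noBacktrack-snoc w (z ∷ xs) u (λ y∈ → y∉ (there y∈))

unique-⊆ : ∀ {n} {xs ys : List (Fin n)} → xs ⊆ ys → Unique ys → Unique xs
unique-⊆ []         []       = []
unique-⊆ (_ ∷ʳ sub) (_ ∷ u)  = unique-⊆ sub u
unique-⊆ (refl ∷ sub) (y∉ ∷ u) = All-resp-⊆ sub y∉ ∷ unique-⊆ sub u

concat-↭ : ∀ {n} {ps qs : List (List (Fin n))} → ps ↭ qs → concat ps ↭ concat qs
concat-↭ ↭.refl         = ↭-refl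
concat-↭ (↭.prep p ps↭) = ++⁺ˡ p (concat-↭ ps↭)
concat-↭ (↭.swap p q ps↭) = ↭-trans (shifts p q) (++⁺ˡ q (++⁺ˡ p (concat-↭ ps↭)))
concat-↭ (↭.trans ps↭ qs↭) = ↭-trans (concat-↭ ps↭) (concat-↭ qs↭)

unique-↭ : ∀ {n} {xs ys : List (Fin n)} → xs ↭ ys → Unique xs → Unique ys
unique-↭ {n} xs↭ = PermutationSetoid.Unique-resp-↭ (setoid (Fin n)) (↭⇒↭ₛ xs↭)

∈⇒↭∷ : ∀ {n} {p : List (Fin n)} {ps} → p ∈ ps → ∃ λ qs → ps ↭ p ∷ qs
∈⇒↭∷ {p = p} p∈ with ∈-∃++ p∈
... | ps₁ , ps₂ , refl = ps₁ ++ ps₂ , shift p ps₁ ps₂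

linked-reverse : ∀ {n} (G : Graph n) {xs} → Linked (adj G) xs → Linked (adj G) (reverse xs)
linked-reverse G {[]}     _  = tt
linked-reverse G {x ∷ xs} lk = go x xs [] lk tt
  where
  go : ∀ x xs ys → Linked (adj G) (x ∷ xs) → Linked (adj G) (x ∷ ys) → Linked (adj G) (xs ʳ++ (x ∷ ys))
  go x []       ys _         lk′ = lk′
  go x (y ∷ xs) ys (xy , lk) lk′ = go y xs (x ∷ ys) lk (trans (Graph.sym G y x) xy , lk′)

linked-++ˡ : ∀ {n} (R : BRel n) xs {ys} → Linked R (xs ++ ys) → Linked R xs
linked-++ˡ R []           _        = tt
linked-++ˡ R (x ∷ [])     _        = tt
linked-++ˡ R (x ∷ y ∷ xs) (xy , lk) = xy , linked-++ˡ R (y ∷ xs) lk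

linked-++ʳ : ∀ {n} (R : BRel n) xs {ys} → Linked R (xs ++ ys) → Linked R ys
linked-++ʳ R []                   lk       = lk
linked-++ʳ R (x ∷ []) {[]}        _        = tt
linked-++ʳ R (x ∷ []) {y ∷ ys}    (_ , lk) = lk
linked-++ʳ R (x ∷ y ∷ xs)         (_ , lk) = linked-++ʳ R (y ∷ xs) lk

-- Spanning trees from parent functions

module ParentTree {n} (G : Graph n) (parent : Fin n → Maybe (Fin n)) (rank : Fin n → ℕ) (root : Fin n)
  (parentless⇒root : ∀ {v} → parent v ≡ nothing → v ≡ root)
  (parent-adj : ∀ {v p} → parent v ≡ just p → adj G v p ≡ true)
  (parent-rank : ∀ {v p} → parent v ≡ just p → rank p < rank v) where

  _≟ₘ_ : (a b : Maybe (Fin n)) → Dec (a ≡ b)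
  _≟ₘ_ = ≡-dec _≟_

  edge : BRel n
  edge u w = does (parent u ≟ₘ just w) ∨ does (parent w ≟ₘ just u)

  edge-sym : ∀ u w → edge u w ≡ edge w u
  edge-sym u w = ∨-comm (does (parent u ≟ₘ just w)) _

  edge-up : ∀ {u w} → parent u ≡ just w → edge u w ≡ true
  edge-up {u} {w} e = cong (_∨ does (parent w ≟ₘ just u)) (dec-true (parent u ≟ₘ just w) e)

  edge-down : ∀ {u w} → parent w ≡ just u → edge u w ≡ true
  edge-down {u} {w} e =
    trans (cong (does (parent u ≟ₘ just w) ∨_) (dec-true (parent w ≟ₘ just u) e)) (∨-zeroʳ _)

  edge-cases : ∀ {u w} → edge u w ≡ true → parent u ≡ just w ⊎ parent w ≡ just u
  edge-cases {u} {w} e with parent u ≟ₘ just w | parent w ≟ₘ just u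
  ... | yes up | _       = inj₁ up
  ... | no _   | yes dn  = inj₂ dn

  edge-adj : ∀ u w → edge u w ≡ true → adj G u w ≡ true
  edge-adj u w e with edge-cases e
  ... | inj₁ up = parent-adj up
  ... | inj₂ dn = trans (Graph.sym G u w) (parent-adj dn)

  toRoot : ∀ u → Acc _<_ (rank u) → Joined edge u root
  toRoot u (acc rs) with parent u in pu
  ... | nothing = subst (λ x → Joined edge x root) (sym (parentless⇒root pu)) ε
  ... | just p  = edge-up pu ◅ toRoot p (rs (parent-rank pu))

  edge-connected : ∀ u v → Joined edge u v
  edge-connected u v = toRoot u (<-wellFounded _) ◅◅
    Star.reverse (λ {a} {b} e → trans (edge-sym b a) e) (toRoot v (<-wellFounded _))

  Descending : List (Fin n) → Set
  Descending (u ∷ v ∷ rs) = parent v ≡ just u × Descending (v ∷ rs)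
  Descending _            = ⊤

  Ascending : List (Fin n) → Set
  Ascending (u ∷ v ∷ rs) = parent u ≡ just v × Ascending (v ∷ rs)
  Ascending _            = ⊤

  EndsDescending : List (Fin n) → Set
  EndsDescending (u ∷ v ∷ [])     = parent v ≡ just u
  EndsDescending (u ∷ v ∷ w ∷ rs) = EndsDescending (v ∷ w ∷ rs)
  EndsDescending _                = ⊤

  -- After a step down, a step up would return to the vertex just left.
  descending : ∀ u v rs → Linked edge (u ∷ v ∷ rs) → NoBacktrack (u ∷ v ∷ rs) →
    parent v ≡ just u → Descending (u ∷ v ∷ rs)
  descending u v []       _        _          dn = dn , tt
  descending u v (w ∷ rs) (_ , lk) (u≢w , nb) dn with edge-cases (proj₁ lk)
  ... | inj₁ up  = ⊥-elim (u≢w (just-injective (trans (sym dn) up)))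
  ... | inj₂ dn′ = dn , descending v w rs lk nb dn′

  ascending-or-endsDescending : ∀ u v rs → Linked edge (u ∷ v ∷ rs) → NoBacktrack (u ∷ v ∷ rs) →
    Ascending (u ∷ v ∷ rs) ⊎ EndsDescending (u ∷ v ∷ rs)
  ascending-or-endsDescending u v [] (e , _) _ with edge-cases e
  ... | inj₁ up = inj₁ (up , tt)
  ... | inj₂ dn = inj₂ dn
  ascending-or-endsDescending u v (w ∷ rs) (e , lk) (u≢w , nb)
    with ascending-or-endsDescending v w rs lk nb
  ... | inj₂ ends = inj₂ ends
  ... | inj₁ (upv , asc) with edge-cases e
  ...   | inj₁ up = inj₁ (up , upv , asc)
  ...   | inj₂ dn = ⊥-elim (u≢w (just-injective (trans (sym dn) upv)))

  rank-descending : ∀ u v rs {z} → Descending (u ∷ v ∷ rs) → last (u ∷ v ∷ rs) ≡ just z →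
    rank u < rank z
  rank-descending u v []       (dn , _)   refl  = parent-rank dn
  rank-descending u v (w ∷ rs) (dn , dsc) last≡ = <-trans (parent-rank dn) (rank-descending v w rs dsc last≡)

  rank-ascending : ∀ u v rs {z} → Ascending (u ∷ v ∷ rs) → last (u ∷ v ∷ rs) ≡ just z →
    rank z < rank u
  rank-ascending u v []       (up , _)   refl  = parent-rank up
  rank-ascending u v (w ∷ rs) (up , asc) last≡ = <-trans (rank-ascending v w rs asc last≡) (parent-rank up)

  endsDescending-snoc : ∀ x xs {y z} → last (x ∷ xs) ≡ just z → EndsDescending ((x ∷ xs) ++ [ y ]) →
    parent y ≡ just z
  endsDescending-snoc x []           refl  ends = ends
  endsDescending-snoc x (w ∷ [])     last≡ ends = endsDescending-snoc w [] last≡ ends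
  endsDescending-snoc x (w ∷ v ∷ xs) last≡ ends = endsDescending-snoc w (v ∷ xs) last≡ ends

  -- Going round the cycle from a, a first step down forces a descent all the way back to a; after a
  -- first step up to b, either the walk ascends all the way back to a or its last step descends
  -- into a from the parent of a, which is b.
  edge-acyclic : ¬ HasCycle edge
  edge-acyclic (a , b , c , rs , u , lk , z , last≡ , ez) = around (edge-cases (proj₁ lk))
    where
    a∉ : a ∉ b ∷ c ∷ rs
    a∉ a∈ = All.lookup (AllPairs.head u) a∈ refl
    cycle : List (Fin n)
    cycle = c ∷ rs ++ [ a ]
    linked : Linked edge (a ∷ b ∷ cycle)
    linked = linked-snoc edge a (b ∷ c ∷ rs) lk last≡ ez
    noBacktrack : NoBacktrack (a ∷ b ∷ cycle)
    noBacktrack = (λ a≡c → a∉ (there (here a≡c))) , noBacktrack-snoc b (c ∷ rs) (AllPairs.tail u) a∉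
    closed : last (a ∷ b ∷ cycle) ≡ just a
    closed = last-snoc (a ∷ b ∷ c ∷ rs) a
    around : parent a ≡ just b ⊎ parent b ≡ just a → ⊥
    around (inj₂ dn) = <-irrefl refl (rank-descending a b cycle (descending a b cycle linked noBacktrack dn) closed)
    around (inj₁ up) with ascending-or-endsDescending a b cycle linked noBacktrack
    ... | inj₁ asc  = <-irrefl refl (rank-ascending a b cycle asc closed)
    ... | inj₂ ends =
      All.lookup (AllPairs.head (AllPairs.tail u)) (subst (_∈ c ∷ rs) z≡b (last-∈ c rs last≡)) refl
      where
      z≡b : z ≡ b
      z≡b = just-injective (trans (sym (endsDescending-snoc a (b ∷ c ∷ rs) last≡ ends)) up)

  tree : SpanningTree G
  tree = record { edge = edge ; sym = edge-sym ; sub = edge-adj ; connected = edge-connected ; acyclic = edge-acyclic }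

  branching⇒2≤deg : ∀ {v p s} → parent v ≡ just p → parent s ≡ just v → (2 ≤ᵇ degT tree v) ≡ true
  branching⇒2≤deg {v} {p} {s} pv ps = 2≤ᵇ (2≤count (edge v) p≢s (edge-up pv) (edge-down ps))
    where
    p≢s : p ≢ s
    p≢s p≡s = <⇒≢ (<-trans (parent-rank pv) (parent-rank ps)) (cong rank p≡s)
    2≤ᵇ : ∀ {d} → 2 ≤ d → (2 ≤ᵇ d) ≡ true
    2≤ᵇ (s≤s (s≤s _)) = refl

-- Growing a spanning tree one leaf at a time

-- (v , p) attaches v to the tree as a child of p.
Attachment : ℕ → Set
Attachment n = Fin n × Fin n

children : ∀ {n} → List (Attachment n) → List (Fin n)
children = map proj₁

parentIn : ∀ {n} → List (Attachment n) → Fin n → Maybe (Fin n)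
parentIn []            v = nothing
parentIn ((u , p) ∷ L) v with u ≟ v
... | yes _ = just p
... | no  _ = parentIn L v

parentIn-∈ : ∀ {n} (L : List (Attachment n)) {v p} → parentIn L v ≡ just p → (v , p) ∈ L
parentIn-∈ ((u , q) ∷ L) {v} e with u ≟ v
parentIn-∈ ((u , q) ∷ L) refl | yes refl = here refl
... | no _ = there (parentIn-∈ L e)

parentIn-∉ : ∀ {n} (L : List (Attachment n)) {v} → parentIn L v ≡ nothing → v ∉ children L
parentIn-∉ ((u , q) ∷ L) {v} e v∈ with u ≟ v
parentIn-∉ ((u , q) ∷ L) () v∈ | yes _
parentIn-∉ ((u , q) ∷ L) e (here refl) | no u≢v = u≢v refl
parentIn-∉ ((u , q) ∷ L) e (there v∈) | no _   = parentIn-∉ L e v∈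

∈⇒parentIn : ∀ {n} {L : List (Attachment n)} {v p} → Unique (children L) → (v , p) ∈ L →
  parentIn L v ≡ just p
∈⇒parentIn {L = (u , q) ∷ L} {v} _ (here refl) with u ≟ v
... | yes _   = refl
... | no u≢v  = ⊥-elim (u≢v refl)
∈⇒parentIn {L = (u , q) ∷ L} {v} (u∉ ∷ uL) (there vp∈) with u ≟ v
... | yes refl = ⊥-elim (All.lookup u∉ (∈-map⁺ proj₁ vp∈) refl)
... | no _     = ∈⇒parentIn uL vp∈

Branching : ∀ {n} → List (Attachment n) → Fin n → Set
Branching L v = (∃ λ p → (v , p) ∈ L) × (∃ λ s → (s , v) ∈ L)

module _ {n} (G : Graph n) where

  Grown : List (Fin n) → List (Attachment n) → Set
  Grown D []            = ⊤
  Grown D ((v , p) ∷ L) = p ∈ D × adj G v p ≡ true × Grown (D ++ [ v ]) L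

  grown-adj : ∀ {D L v p} → Grown D L → (v , p) ∈ L → adj G v p ≡ true
  grown-adj {L = _ ∷ L} (_ , vp , _) (here refl) = vp
  grown-adj {L = _ ∷ L} (_ , _ , gr) (there vp∈) = grown-adj gr vp∈

  grown-pos : ∀ {D L v p} → Grown D L → Unique (D ++ children L) → (v , p) ∈ L →
    pos (D ++ children L) p < pos (D ++ children L) v
  grown-pos {D} {(v , _) ∷ L} (p∈ , _ , _) u (here refl) = pos-++-< D (v ∷ children L) u p∈ (here refl)
  grown-pos {D} {(w , _) ∷ L} {v} {p} (_ , _ , gr) u (there vp∈) =
    subst (λ W → pos W p < pos W v) assoc (grown-pos gr (subst Unique (sym assoc) u) vp∈)
    where
    assoc : (D ++ [ w ]) ++ children L ≡ D ++ w ∷ children L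
    assoc = ++-assoc D [ w ] (children L)

  grown-++ : ∀ {D} L₁ {L₂} → Grown D L₁ → Grown (D ++ children L₁) L₂ → Grown D (L₁ ++ L₂)
  grown-++ {D} []               _            gr₂ = subst (λ E → Grown E _) (++-identityʳ D) gr₂
  grown-++ {D} ((v , p) ∷ L₁) {L₂} (p∈ , vp , gr₁) gr₂ =
    p∈ , vp , grown-++ L₁ gr₁ (subst (λ E → Grown E L₂) (sym (++-assoc D [ v ] (children L₁))) gr₂)

  optAtLeast-grown : ∀ r L → Grown [ r ] L → Unique (r ∷ children L) → (∀ v → v ∈ r ∷ children L) →
    ∀ {I} → Unique I → All (Branching L) I → OptAtLeast G (length I)
  optAtLeast-grown r L grown u covers uI branching = tree , length≤count _ uI (All.map 2≤deg branching)
    where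
    parentless⇒root : ∀ {v} → parentIn L v ≡ nothing → v ≡ r
    parentless⇒root {v} e with covers v
    ... | here v≡r = v≡r
    ... | there v∈ = ⊥-elim (parentIn-∉ L e v∈)
    open ParentTree G (parentIn L) (pos (r ∷ children L)) r parentless⇒root
      (λ e → grown-adj grown (parentIn-∈ L e)) (λ e → grown-pos grown u (parentIn-∈ L e))
    2≤deg : ∀ {v} → Branching L v → (2 ≤ᵇ degT tree v) ≡ true
    2≤deg ((_ , vp∈) , (_ , sv∈)) =
      branching⇒2≤deg (∈⇒parentIn (AllPairs.tail u) vp∈) (∈⇒parentIn (AllPairs.tail u) sv∈)

-- Hanging paths below anchors

chain : ∀ {n} → Fin n → List (Fin n) → List (Attachment n)
chain a []       = []
chain a (x ∷ xs) = (x , a) ∷ chain x xs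

init : ∀ {n} → List (Fin n) → List (Fin n)
init []           = []
init (x ∷ [])     = []
init (x ∷ y ∷ xs) = x ∷ init (y ∷ xs)

children-chain : ∀ {n} (a : Fin n) xs → children (chain a xs) ≡ xs
children-chain a []       = refl
children-chain a (x ∷ xs) = cong (x ∷_) (children-chain x xs)

length-init : ∀ {n} (xs : List (Fin n)) → length (init xs) ≡ length xs ∸ 1
length-init []           = refl
length-init (x ∷ [])     = refl
length-init (x ∷ y ∷ xs) = cong suc (length-init (y ∷ xs))

init-⊆ : ∀ {n} (xs : List (Fin n)) → init xs ⊆ xs
init-⊆ []           = []
init-⊆ (x ∷ [])     = x ∷ʳ []
init-⊆ (x ∷ y ∷ xs) = refl ∷ init-⊆ (y ∷ xs)

branching-chain : ∀ {n} (a : Fin n) xs {v} → v ∈ init xs → Branching (chain a xs) v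
branching-chain a (x ∷ y ∷ xs) (here refl) = (a , here refl) , (y , there (here refl))
branching-chain a (x ∷ y ∷ xs) (there v∈) with branching-chain x (y ∷ xs) v∈
... | (p , vp∈) , (s , sv∈) = (p , there vp∈) , (s , there sv∈)

branching-++ˡ : ∀ {n} (L L′ : List (Attachment n)) {v} → Branching L v → Branching (L ++ L′) v
branching-++ˡ L L′ ((p , vp∈) , (s , sv∈)) = (p , ∈-++⁺ˡ vp∈) , (s , ∈-++⁺ˡ sv∈)

branching-++ʳ : ∀ {n} (L L′ : List (Attachment n)) {v} → Branching L′ v → Branching (L ++ L′) v
branching-++ʳ L L′ ((p , vp∈) , (s , sv∈)) = (p , ∈-++⁺ʳ L vp∈) , (s , ∈-++⁺ʳ L sv∈)

pathEdges : ∀ {n} → List (Fin n) → ℕ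
pathEdges p = length p ∸ 1

Hanging : ℕ → Set
Hanging n = Fin n × List (Fin n)

attachments : ∀ {n} → List (Hanging n) → List (Attachment n)
attachments []             = []
attachments ((a , c) ∷ hs) = chain a c ++ attachments hs

hung : ∀ {n} → List (Hanging n) → List (Fin n)
hung hs = concat (map proj₂ hs)

inner : ∀ {n} → List (Hanging n) → List (Fin n)
inner []             = []
inner ((a , c) ∷ hs) = init c ++ inner hs

children-attachments : ∀ {n} (hs : List (Hanging n)) → children (attachments hs) ≡ hung hs
children-attachments []             = refl
children-attachments ((a , c) ∷ hs) =
  trans (map-++ proj₁ (chain a c) (attachments hs)) (cong₂ _++_ (children-chain a c) (children-attachments hs))

length-inner : ∀ {n} (hs : List (Hanging n)) → length (inner hs) ≡ sum (map pathEdges (map proj₂ hs))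
length-inner []             = refl
length-inner ((a , c) ∷ hs) = trans (length-++ (init c)) (cong₂ _+_ (length-init c) (length-inner hs))

inner-⊆ : ∀ {n} (hs : List (Hanging n)) → inner hs ⊆ hung hs
inner-⊆ []             = []
inner-⊆ ((a , c) ∷ hs) = ++⁺ (init-⊆ c) (inner-⊆ hs)

branching-inner : ∀ {n} (hs : List (Hanging n)) → All (Branching (attachments hs)) (inner hs)
branching-inner []             = []
branching-inner ((a , c) ∷ hs) = AllProperties.++⁺
  (All.tabulate (λ v∈ → branching-++ˡ (chain a c) _ (branching-chain a c v∈)))
  (All.map (branching-++ʳ (chain a c) _) (branching-inner hs))

Partition : ∀ {n} → List (List (Fin n)) → Set
Partition ps = Unique (concat ps) × (∀ v → v ∈ concat ps)

partition-↭ : ∀ {n} {ps qs : List (List (Fin n))} → ps ↭ qs → Partition ps → Partition qs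
partition-↭ ps↭ (u , covers) =
  unique-↭ (concat-↭ ps↭) u , λ v → ∈-resp-↭ (concat-↭ ps↭) (covers v)

sumEdges-↭ : ∀ {n} {ps qs : List (List (Fin n))} → ps ↭ qs →
  sum (map pathEdges ps) ≡ sum (map pathEdges qs)
sumEdges-↭ ps↭ = sum-↭ (map⁺ pathEdges ps↭)

pathEdges-split : ∀ {n} (A : List (Fin n)) {y} B → pathEdges (A ++ y ∷ B) ≡ length A + length B
pathEdges-split A {y} B = cong (_∸ 1) (trans (length-++ A) (+-suc (length A) (length B)))

module _ {n} (G : Graph n) where

  Anchored : List (Fin n) → List (Hanging n) → Set
  Anchored D []             = ⊤
  Anchored D ((a , c) ∷ hs) = a ∈ D × Linked (adj G) (a ∷ c) × Anchored (D ++ c) hs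

  grown-chain : ∀ {D a} c → a ∈ D → Linked (adj G) (a ∷ c) → Grown G D (chain a c)
  grown-chain {D} {a} []       a∈ _          = tt
  grown-chain {D} {a} (x ∷ xs) a∈ (ax , lk) =
    a∈ , trans (Graph.sym G x a) ax , grown-chain xs (∈-++⁺ʳ D (here refl)) lk

  anchored⇒grown : ∀ {D} hs → Anchored D hs → Grown G D (attachments hs)
  anchored⇒grown []                 _               = tt
  anchored⇒grown {D} ((a , c) ∷ hs) (a∈ , lk , anc) = grown-++ G (chain a c)
    (grown-chain c a∈ lk)
    (subst (λ E → Grown G (D ++ E) (attachments hs)) (sym (children-chain a c)) (anchored⇒grown hs anc))

  optAtLeast-anchored : ∀ r hs ps → Anchored [ r ] hs → r ∷ hung hs ↭ concat ps → Partition ps →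
    OptAtLeast G (length (inner hs))
  optAtLeast-anchored r hs ps anc vertices↭ (u , covers) =
    optAtLeast-grown G r (attachments hs) (anchored⇒grown hs anc) unique-children covers-children
      (unique-⊆ (inner-⊆ hs) (AllPairs.tail unique-hung)) (branching-inner hs)
    where
    unique-hung : Unique (r ∷ hung hs)
    unique-hung = unique-↭ (↭-sym vertices↭) u
    children≡ : children (attachments hs) ≡ hung hs
    children≡ = children-attachments hs
    unique-children : Unique (r ∷ children (attachments hs))
    unique-children = subst (λ W → Unique (r ∷ W)) (sym children≡) unique-hung
    covers-children : ∀ v → v ∈ r ∷ children (attachments hs)
    covers-children v =
      subst (λ W → v ∈ r ∷ W) (sym children≡) (∈-resp-↭ (↭-sym vertices↭) (covers v))

-- Graphs with a dominating edge

record DominatingEdge {n} (G : Graph n) : Set where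
  field
    h g       : Fin n
    h~g       : adj G h g ≡ true
    dominates : ∀ v → adj G h v ≡ true ⊎ adj G g v ≡ true

∸2≤∸1+∸1 : ∀ x y → (x + y) ∸ 2 ≤ (x ∸ 1) + (y ∸ 1)
∸2≤∸1+∸1 zero    y       = ∸-monoʳ-≤ y (s≤s z≤n)
∸2≤∸1+∸1 (suc x) zero    = m∸n≤m (x + 0) 1
∸2≤∸1+∸1 (suc x) (suc y) = ≤-reflexive (cong (_∸ 1) (+-suc x y))

rootLoss : ∀ x s → (x + s) ∸ 2 ≤ (x ∸ 1) + s
rootLoss x s = ≤-trans (∸2≤∸1+∸1 x s) (+-monoʳ-≤ (x ∸ 1) (m∸n≤m s 1))

splitLoss : ∀ x a b s → (x + ((a + b) + s)) ∸ 2 ≤ (x ∸ 1) + (b + ((a ∸ 1) + s))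
splitLoss x a b s = ≤-trans (∸2≤∸1+∸1 x ((a + b) + s)) (+-monoʳ-≤ (x ∸ 1) (cut a))
  where
  cut : ∀ a → ((a + b) + s) ∸ 1 ≤ b + ((a ∸ 1) + s)
  cut zero    = m∸n≤m (b + s) 1
  cut (suc a) = ≤-reflexive (trans (cong (_+ s) (+-comm a b)) (+-assoc b a s))

optAtLeast-≤ : ∀ {n} {G : Graph n} {m k} → m ≤ k → OptAtLeast G k → OptAtLeast G m
optAtLeast-≤ m≤k (T , k≤) = T , ≤-trans m≤k k≤

module Dominated {n} {G : Graph n} (D : DominatingEdge G) where

  open DominatingEdge D
  open import Data.List.Membership.DecPropositional (_≟_ {n}) using (_∈?_)

  hub : Fin n → Fin n
  hub v = if adj G h v then h else g

  hub-adj : ∀ v → adj G (hub v) v ≡ true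
  hub-adj v with adj G h v in hv | dominates v
  ... | true  | _       = hv
  ... | false | inj₂ gv = gv

  hub-∈ : ∀ {E} v → h ∈ E → g ∈ E → hub v ∈ E
  hub-∈ v h∈ g∈ with adj G h v
  ... | true  = h∈
  ... | false = g∈

  hang : List (Fin n) → Hanging n
  hang []       = h , []
  hang (x ∷ xs) = hub x , x ∷ xs

  anchored-hang : ∀ {E} qs → h ∈ E → g ∈ E → All (Linked (adj G)) qs → Anchored G E (map hang qs)
  anchored-hang []             _  _  _          = tt
  anchored-hang {E} ([] ∷ qs)  h∈ g∈ (_ ∷ lks)  =
    h∈ , tt , anchored-hang qs (∈-++⁺ˡ h∈) (∈-++⁺ˡ g∈) lks
  anchored-hang {E} ((x ∷ xs) ∷ qs) h∈ g∈ (lk ∷ lks) =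
    hub-∈ x h∈ g∈ , (hub-adj x , lk) , anchored-hang qs (∈-++⁺ˡ h∈) (∈-++⁺ˡ g∈) lks

  map-proj₂-hang : ∀ qs → map proj₂ (map hang qs) ≡ qs
  map-proj₂-hang []              = refl
  map-proj₂-hang ([] ∷ qs)       = cong ([] ∷_) (map-proj₂-hang qs)
  map-proj₂-hang ((x ∷ xs) ∷ qs) = cong ((x ∷ xs) ∷_) (map-proj₂-hang qs)

  optAtLeast-hubsOnRootPath : ∀ r rest qs → h ∈ r ∷ rest → g ∈ r ∷ rest →
    All (Linked (adj G)) ((r ∷ rest) ∷ qs) → Partition ((r ∷ rest) ∷ qs) →
    OptAtLeast G (pathEdges rest + sum (map pathEdges qs))
  optAtLeast-hubsOnRootPath r rest qs h∈ g∈ (lk ∷ lks) part =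
    subst (OptAtLeast G) size (optAtLeast-anchored G r hs ((r ∷ rest) ∷ qs) anchored (↭-reflexive vertices) part)
    where
    hs = (r , rest) ∷ map hang qs
    anchored : Anchored G [ r ] hs
    anchored = here refl , lk , anchored-hang qs h∈ g∈ lks
    vertices : r ∷ hung hs ≡ concat ((r ∷ rest) ∷ qs)
    vertices = cong (λ ps → concat ((r ∷ rest) ∷ ps)) (map-proj₂-hang qs)
    size : length (inner hs) ≡ pathEdges rest + sum (map pathEdges qs)
    size = trans (length-inner hs) (cong (λ ps → pathEdges rest + sum (map pathEdges ps)) (map-proj₂-hang qs))

  optAtLeast-hubsSplit : ∀ r rest A B qs → h ∈ r ∷ rest →
    All (Linked (adj G)) ((r ∷ rest) ∷ (A ++ g ∷ B) ∷ qs) →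
    Partition ((r ∷ rest) ∷ (A ++ g ∷ B) ∷ qs) →
    OptAtLeast G (pathEdges rest + (length B + (pathEdges A + sum (map pathEdges qs))))
  optAtLeast-hubsSplit r rest A B qs h∈ (lk ∷ lkAgB ∷ lks) part =
    subst (OptAtLeast G) size
      (optAtLeast-anchored G r hs ((r ∷ rest) ∷ (A ++ g ∷ B) ∷ qs) anchored vertices part)
    where
    hs = (r , rest) ∷ (h , g ∷ B) ∷ (g , reverse A) ∷ map hang qs
    g∈ : g ∈ (r ∷ rest) ++ g ∷ B
    g∈ = ∈-++⁺ʳ (r ∷ rest) (here refl)
    linked-gA : Linked (adj G) (g ∷ reverse A)
    linked-gA = subst (Linked (adj G)) (reverse-++ A [ g ]) (linked-reverse G
      (linked-++ˡ (adj G) (A ++ [ g ]) (subst (Linked (adj G)) (sym (++-assoc A [ g ] B)) lkAgB)))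
    anchored : Anchored G [ r ] hs
    anchored = here refl , lk , h∈ , (h~g , linked-++ʳ (adj G) A lkAgB) , g∈ , linked-gA ,
      anchored-hang qs (∈-++⁺ˡ (∈-++⁺ˡ h∈)) (∈-++⁺ˡ g∈) lks
    vertices : r ∷ hung hs ↭ concat ((r ∷ rest) ∷ (A ++ g ∷ B) ∷ qs)
    vertices = ++⁺ˡ (r ∷ rest) (begin
      (g ∷ B) ++ reverse A ++ hung (map hang qs)
        ≡⟨ cong (λ ps → (g ∷ B) ++ reverse A ++ concat ps) (map-proj₂-hang qs) ⟩
      (g ∷ B) ++ reverse A ++ concat qs         ↭⟨ shifts (g ∷ B) (reverse A) ⟩
      reverse A ++ (g ∷ B) ++ concat qs         ↭⟨ ++⁺ʳ _ (↭-reverse A) ⟩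
      A ++ (g ∷ B) ++ concat qs                 ≡⟨ ++-assoc A (g ∷ B) (concat qs) ⟨
      (A ++ g ∷ B) ++ concat qs                 ∎)
      where open PermutationReasoning
    size : length (inner hs) ≡ pathEdges rest + (length B + (pathEdges A + sum (map pathEdges qs)))
    size = trans (length-inner hs) (cong (λ m → pathEdges rest + (length B + m))
      (cong₂ _+_ (cong (_∸ 1) (length-reverse A)) (cong (λ ps → sum (map pathEdges ps)) (map-proj₂-hang qs))))

  optAtLeast-hubOffRootPath : ∀ r rest qs → h ∈ r ∷ rest → g ∈ concat qs →
    All (Linked (adj G)) ((r ∷ rest) ∷ qs) → Partition ((r ∷ rest) ∷ qs) →
    OptAtLeast G (sum (map pathEdges ((r ∷ rest) ∷ qs)) ∸ 2)
  optAtLeast-hubOffRootPath r rest qs h∈ g∈ lks part with ∈-concat⁻′ qs g∈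
  ... | gp , g∈gp , gp∈ with ∈⇒↭∷ gp∈ | ∈-∃++ g∈gp
  ...   | qs′ , qs↭ | A , B , refl =
    subst (λ m → OptAtLeast G (m ∸ 2)) (sym (sumEdges-↭ perm)) (optAtLeast-≤ loss
      (optAtLeast-hubsSplit r rest A B qs′ h∈ (All-resp-↭ perm lks) (partition-↭ perm part)))
    where
    perm = ↭.prep (r ∷ rest) qs↭
    loss : (length rest + (pathEdges (A ++ g ∷ B) + sum (map pathEdges qs′))) ∸ 2 ≤
           pathEdges rest + (length B + (pathEdges A + sum (map pathEdges qs′)))
    loss rewrite pathEdges-split A {g} B = splitLoss (length rest) (length A) (length B) _

  optAtLeast-rootPath : ∀ r rest qs → h ∈ r ∷ rest →
    All (Linked (adj G)) ((r ∷ rest) ∷ qs) → Partition ((r ∷ rest) ∷ qs) →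
    OptAtLeast G (sum (map pathEdges ((r ∷ rest) ∷ qs)) ∸ 2)
  optAtLeast-rootPath r rest qs h∈ lks part with g ∈? (r ∷ rest)
  ... | yes g∈ = optAtLeast-≤ (rootLoss (length rest) _) (optAtLeast-hubsOnRootPath r rest qs h∈ g∈ lks part)
  ... | no g∉ with ∈-++⁻ (r ∷ rest) (proj₂ part g)
  ...   | inj₁ g∈ = ⊥-elim (g∉ g∈)
  ...   | inj₂ g∈ = optAtLeast-hubOffRootPath r rest qs h∈ g∈ lks part

  optAtLeast-partitionIntoPaths : ∀ ps → All (Linked (adj G)) ps → Partition ps →
    OptAtLeast G (sum (map pathEdges ps) ∸ 2)
  optAtLeast-partitionIntoPaths ps lks part with ∈-concat⁻′ ps (proj₂ part h)
  ... | r ∷ rest , h∈ , hp∈ with ∈⇒↭∷ hp∈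
  ...   | qs , ps↭ = subst (λ m → OptAtLeast G (m ∸ 2)) (sym (sumEdges-↭ ps↭))
    (optAtLeast-rootPath r rest qs h∈ (All-resp-↭ ps↭ lks) (partition-↭ ps↭ part))

optAtLeast-pathCover : ∀ {n} {G : Graph n} → DominatingEdge G → (P : PathCover G) →
  OptAtLeast G (pcEdges P ∸ 2)
optAtLeast-pathCover D P = Dominated.optAtLeast-partitionIntoPaths D (PathCover.paths P)
  (All.map (λ isPath → proj₂ (proj₂ isPath)) (PathCover.arePaths P)) (PathCover.disjoint P , PathCover.covers P)

-- Connected chain graphs

neighbour : ∀ {n} (G : Graph n) → Connected G → ∀ {u v} → u ≢ v → ∃ λ w → adj G u w ≡ true
neighbour G conn {u} {v} u≢v with conn u v
... | ε     = ⊥-elim (u≢v refl)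
... | e ◅ _ = _ , e

everyVertexHasNeighbour : ∀ {n} (G : Graph n) → Connected G → ∀ {u₀ u₁} → u₀ ≢ u₁ →
  ∀ v → ∃ λ w → adj G v w ≡ true
everyVertexHasNeighbour G conn {u₀} {u₁} u₀≢u₁ v with v ≟ u₀
... | yes refl = neighbour G conn u₀≢u₁
... | no v≢u₀  = neighbour G conn v≢u₀

side-neighbour : ∀ {n} {G : Graph n} (cs : ChainStructure G) {u w} → adj G u w ≡ true →
  ChainStructure.side cs w ≡ not (ChainStructure.side cs u)
side-neighbour {G = G} cs {u} {w} uw = ¬-not (ChainStructure.bipartite cs w u (trans (Graph.sym G w u) uw))

extremes : ∀ {m} → Fin m → Σ (Fin m) λ top → Σ (Fin m) λ bottom →
  (∀ (i : Fin m) → i ≤ᶠ top) × (∀ (i : Fin m) → bottom ≤ᶠ i)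
extremes {suc m} _ = fromℕ m , zero , ≤fromℕ , λ _ → z≤n

chainGraph-dominatingEdge : ∀ {n} {G : Graph n} → IsChainGraph G → Connected G →
  ∀ {u₀ u₁ : Fin n} → u₀ ≢ u₁ → DominatingEdge G
chainGraph-dominatingEdge {n} {G} cs conn {u₀} u₀≢u₁ =
  record { h = h ; g = g ; h~g = h-universal g side-g ; dominates = dominates }
  where
  open ChainStructure cs
  nb : ∀ v → ∃ λ w → adj G v w ≡ true
  nb = everyVertexHasNeighbour G conn u₀≢u₁
  someX : Fin k
  someX with side u₀ in s₀
  ... | true  = proj₁ (ord-onto u₀ s₀)
  ... | false = proj₁ (ord-onto (proj₁ (nb u₀)) (trans (side-neighbour cs (proj₂ (nb u₀))) (cong not s₀)))
  top bottom : Fin k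
  top    = proj₁ (extremes someX)
  bottom = proj₁ (proj₂ (extremes someX))
  ≤top : ∀ i → i ≤ᶠ top
  ≤top = proj₁ (proj₂ (proj₂ (extremes someX)))
  bottom≤ : ∀ i → bottom ≤ᶠ i
  bottom≤ = proj₂ (proj₂ (proj₂ (extremes someX)))
  h g : Fin n
  h = ord top
  g = proj₁ (nb (ord bottom))
  side-g : side g ≡ false
  side-g = trans (side-neighbour cs (proj₂ (nb (ord bottom)))) (cong not (ord-inX bottom))
  g-universal : ∀ x → side x ≡ true → adj G x g ≡ true
  g-universal x sx with ord-onto x sx
  ... | i , refl = nested bottom i (bottom≤ i) g (proj₂ (nb (ord bottom)))
  h-universal : ∀ y → side y ≡ false → adj G h y ≡ true
  h-universal y sy with nb y
  ... | u , yu with ord-onto u (trans (side-neighbour cs yu) (cong not sy))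
  ...   | j , refl = nested j top (≤top j) y (trans (Graph.sym G (ord j) y) yu)
  dominates : ∀ v → adj G h v ≡ true ⊎ adj G g v ≡ true
  dominates v with side v in sv
  ... | true  = inj₂ (trans (Graph.sym G g v) (g-universal v sv))
  ... | false = inj₁ (h-universal v sv)

edgelessTree : ∀ {n} (G : Graph n) → (∀ u v → u ≡ v) → SpanningTree G
edgelessTree G allEqual = record
  { edge = λ _ _ → false ; sym = λ _ _ → refl ; sub = λ _ _ () ; connected = connected
  ; acyclic = λ { (_ , _ , _ , _ , _ , (() , _) , _) } }
  where
  connected : ∀ u v → Joined (λ _ _ → false) u v
  connected u v rewrite allEqual u v = ε

pcEdges≤n : ∀ {n} {G : Graph n} (P : PathCover G) → pcEdges P ≤ n
pcEdges≤n P = ≤-trans (sumEdges≤length (PathCover.paths P)) (unique-length≤ (PathCover.disjoint P))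
  where
  sumEdges≤length : ∀ {n} (ps : List (List (Fin n))) → sum (map pathEdges ps) ≤ length (concat ps)
  sumEdges≤length []       = z≤n
  sumEdges≤length (p ∷ ps) =
    ≤-trans (+-mono-≤ (m∸n≤m (length p) 1) (sumEdges≤length ps)) (≤-reflexive (sym (length-++ p)))

optAtLeast-small : ∀ {n} (G : Graph n) → n ≤ 1 → (P : PathCover G) → OptAtLeast G (pcEdges P ∸ 2)
optAtLeast-small G n≤1 P = edgelessTree G (allEqual n≤1) ,
  ≤-trans (≤-reflexive (m≤n⇒m∸n≡0 (≤-trans (pcEdges≤n P) (≤-trans n≤1 (n≤1+n 1))))) z≤n
  where
  allEqual : ∀ {n} → n ≤ 1 → (u v : Fin n) → u ≡ v
  allEqual {suc zero}    _        zero zero = refl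
  allEqual {suc (suc _)} (s≤s ()) _    _

theorem5 : ∀ (n : ℕ) (G : Graph n) → IsChainGraph G → Connected G →
    (P : PathCover G) → IsOptimalPathCover G P →
    OptAtLeast G (pcEdges P ∸ 2)
theorem5 zero          G _  _    P _ = optAtLeast-small G z≤n P
theorem5 (suc zero)    G _  _    P _ = optAtLeast-small G (s≤s z≤n) P
theorem5 (suc (suc _)) G cs conn P _ =
  optAtLeast-pathCover (chainGraph-dominatingEdge cs conn {zero} {suc zero} (λ ())) P
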